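{- Let $k$ be a power of $2$ and let $BIN_k$ be the complete binary tree with $k-1$ vertices (levels $0,\dots,\log_2 k-1$, level $i$ having $2^i$ vertices). Then, for a uniformly random ordering of its vertices, the probability that $T_2(BIN_k)=BIN_k$ is at least $2^{ -2k}$.
   Context: For a finite graph $G$ and an ordering $\pi$ of its vertices, $T_2(G,\pi)$ is the subgraph of $G$ induced on the vertices having at most one neighbor preceding them in $\pi$; $T_2(G)$ denotes this random subgraph for uniformly random $\pi$. -}

module Defs where

open import Data.Nat using (ℕ; zero; suc; _≤_; _∸_; _^_; _*_)
open import Data.Nat.DivMod using (_/_)
open import Data.Bool using (Bool; _∨_)
open import Data.Fin using (Fin; toℕ)
open import Data.List using (List; []; _∷_; length; filter; allFin)
open import Data.Product using (_×_)
open import Data.Unit using (⊤)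
open import Relation.Nullary.Decidable using (does)
open import Relation.Binary.PropositionalEquality using (_≡_)
import Data.Nat as ℕ

Graph : ℕ → Set
Graph n = Fin n → Fin n → Bool

-- The complete binary tree on vertices Fin n in heap order: vertex a (0-based)
-- has parent b iff suc b = (suc a) / 2, i.e. children of b are 2b+1 and 2b+2.
-- With n = 2^m - 1 this is BIN_k for k = 2^m (levels 0..m-1, level i has 2^i vertices).
isParent : ℕ → ℕ → Bool
isParent a b = does (suc b ℕ.≟ (suc a / 2))

BINGraph : (n : ℕ) → Graph n
BINGraph n u v = isParent (toℕ u) (toℕ v) ∨ isParent (toℕ v) (toℕ u)

BIN : (k : ℕ) → Graph (k ∸ 1)
BIN k = BINGraph (k ∸ 1)

precNbrs : ∀ {n} → Graph n → Fin n → List (Fin n) → ℕ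
precNbrs G v xs = length (filter (λ u → Data.Bool._≟_ (G u v) Data.Bool.true) xs)

AllT2 : ∀ {n} → Graph n → List (Fin n) → List (Fin n) → Set
AllT2 G seen []       = ⊤
AllT2 G seen (v ∷ vs) = (precNbrs G v seen ≤ 1) × AllT2 G (v ∷ seen) vs

-- T_2(G, π) = G : every vertex has at most one neighbour preceding it in π.
-- (π is an ordering of the vertices, i.e. a list that is a permutation of allFin n.)
T2IsWhole : ∀ {n} → Graph n → List (Fin n) → Set
T2IsWhole G π = AllT2 G [] π

-- Call an ordering of BIN_k parent-first if every vertex comes after its parent, i.e. if it is a
-- linear extension of the heap order. In a parent-first ordering the only neighbour that can
-- precede a vertex is its parent, its children all coming later, so T₂(BIN_k, π) = BIN_k.
-- Linear extensions of a rooted tree are counted by the hook length formula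
-- n! = #extensions · ∏ᵥ |subtree(v)|, proved by interleaving the extensions of the two subtrees.
-- For the complete binary tree of depth m the hook product is at most 2^(2^(m+1)) / 2^(m+2) ≤ 2^(2k),
-- so at least (k-1)! / 2^(2k) of the (k-1)! orderings are parent-first.
module Submission where

open import Data.Bool using (true; T)
import Data.Bool as Bool
open import Data.Bool.Properties using (T-∨; T-≡)
open import Data.Empty using (⊥-elim)
open import Data.Fin using (Fin; toℕ)
open import Data.Fin.Properties using (toℕ-injective)
open import Data.List using (List; []; _∷_; [_]; _++_; map; concat; concatMap; cartesianProduct; length; filter; applyUpTo; upTo; tabulate; allFin)
open import Data.List.Properties using (length-++; length-map; ++-assoc; ++-identityʳ; map-++; concat-++; applyUpTo-∷ʳ; map-upTo; map-injective; map-tabulate; filter-none; ∷-injectiveˡ; ∷-injectiveʳ)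
open import Data.List.Membership.Propositional using (_∈_; _∉_; find)
open import Data.List.Membership.Propositional.Properties using (∈-++⁻; ∈-++⁺ʳ; ∈-map⁺; ∈-map⁻; ∈-concatMap⁻; ∈-cartesianProduct⁻)
open import Data.List.Relation.Binary.Disjoint.Propositional using (Disjoint)
open import Data.List.Relation.Binary.Permutation.Propositional using (_↭_; prep; ↭-refl; ↭-sym; ↭-trans; ↭-reflexive; ↭⇒↭ₛ; module PermutationReasoning)
open import Data.List.Relation.Binary.Permutation.Propositional.Properties using (shifts; ++⁺ˡ; ++⁺; ∈-resp-↭; ↭-length; ↭-map-inv)
import Data.List.Relation.Binary.Permutation.Setoid.Properties as PermutationSetoid
open import Data.List.Relation.Binary.Pointwise using (≡⇒Pointwise-≡)
open import Data.List.Relation.Binary.Subset.Propositional using (_⊆_)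
open import Data.List.Relation.Binary.Subset.Propositional.Properties using (xs⊆x∷xs; ∷⁺ʳ; Any-resp-⊆)
open import Data.List.Relation.Ternary.Interleaving.Propositional using (Interleaving; []; consˡ; consʳ; left; right; toPermutation)
open import Data.List.Relation.Unary.All as All using (All; []; _∷_)
import Data.List.Relation.Unary.All.Properties as All
open import Data.List.Relation.Unary.AllPairs using ([]; _∷_)
open import Data.List.Relation.Unary.Any using (Any; here; there)
open import Data.List.Relation.Unary.Unique.Propositional using (Unique)
import Data.List.Relation.Unary.Unique.Propositional.Properties as Unique
open import Data.Nat using (ℕ; zero; suc; _+_; _*_; _∸_; _^_; _≤_; _!; z≤n; s≤s)
open import Data.Nat.Combinatorics using (_C_; nCn≡1; nCk≡n!/k![n-k]!; k![n∸k]!∣n!; nCk+nC[k+1]≡[n+1]C[k+1])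
open import Data.Nat.DivMod using (_/_; m/n*n≡m; m/n≡1+[m∸n]/n)
open import Data.Nat.Properties
open import Data.Nat.Tactic.RingSolver using (solve-∀)
open import Data.Product using (Σ; _×_; _,_; ∃-syntax; uncurry)
open import Data.Sum as Sum using (_⊎_; inj₁; inj₂)
open import Data.Tree.Binary using (Tree; leaf; node; #nodes)
open import Data.Unit using (⊤; tt)
open import Function using (id; _∘_)
open import Function.Bundles using (Equivalence)
open import Relation.Binary.PropositionalEquality using (_≡_; _≢_; refl; sym; trans; cong; cong₂; subst; setoid; module ≡-Reasoning)
open import Relation.Nullary using (yes; no)
open import Relation.Unary using (Decidable)

open import Defs

private variable
  A B : Set
  xs ys zs xs′ ys′ : List A

length-concatMap : ∀ (f : A → List B) {k} xs → (∀ {x} → x ∈ xs → length (f x) ≡ k) →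
                   length (concatMap f xs) ≡ length xs * k
length-concatMap f []       eq = refl
length-concatMap f (x ∷ xs) eq = trans (length-++ (f x))
  (cong₂ _+_ (eq (here refl)) (length-concatMap f xs (eq ∘ there)))

length-cartesianProduct : ∀ (xs : List A) (ys : List B) →
                          length (cartesianProduct xs ys) ≡ length xs * length ys
length-cartesianProduct []       ys = refl
length-cartesianProduct (x ∷ xs) ys = trans (length-++ (map (x ,_) ys))
  (cong₂ _+_ (length-map (x ,_) ys) (length-cartesianProduct xs ys))

length-filter≤1 : ∀ {P : A → Set} (P? : Decidable P) {xs} → Unique xs →
                  (∀ {x y} → x ∈ xs → y ∈ xs → P x → P y → x ≡ y) → length (filter P? xs) ≤ 1
length-filter≤1 P? {[]}     _          _        = z≤n
length-filter≤1 P? {x ∷ xs} (x∉ ∷ xs!) P-unique with P? x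
... | yes px = s≤s (≤-reflexive (cong length (filter-none P? (All.tabulate λ y∈ py →
                 All.lookup x∉ y∈ (P-unique (here refl) (there y∈) px py)))))
... | no _   = length-filter≤1 P? xs! (λ p q → P-unique (there p) (there q))

Unique-++⁻ : ∀ (xs : List A) {ys} → Unique (xs ++ ys) → Unique xs × Unique ys × Disjoint xs ys
Unique-++⁻ []       ys!            = [] , ys! , λ ()
Unique-++⁻ (x ∷ xs) (x∉ ∷ xs++ys!) with xs! , ys! , xs#ys ← Unique-++⁻ xs xs++ys! =
  All.++⁻ˡ xs x∉ ∷ xs! , ys! , λ where
    (here refl , x∈ys) → All.lookup x∉ (∈-++⁺ʳ xs x∈ys) refl
    (there p   , q)    → xs#ys (p , q)

Unique-concatMap⁺ : ∀ (f : A → List B) {xs} → Unique xs → (∀ {x} → x ∈ xs → Unique (f x)) →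
                    (∀ {x y z} → x ∈ xs → y ∈ xs → z ∈ f x → z ∈ f y → x ≡ y) →
                    Unique (concatMap f xs)
Unique-concatMap⁺ f {[]}     []         _  _   = []
Unique-concatMap⁺ f {x ∷ xs} (x∉ ∷ xs!) f! inj =
  Unique.++⁺ (f! (here refl)) (Unique-concatMap⁺ f xs! (f! ∘ there) (λ p q → inj (there p) (there q))) disjoint
  where
  disjoint : Disjoint (f x) (concatMap f xs)
  disjoint (z∈fx , z∈rest) with y , y∈ , z∈fy ← find (∈-concatMap⁻ f {xs = xs} z∈rest) =
    All.lookup x∉ y∈ (inj (here refl) (there y∈) z∈fx z∈fy)

Unique-resp-↭ : xs ↭ ys → Unique xs → Unique ys
Unique-resp-↭ xs↭ys = PermutationSetoid.Unique-resp-↭ (setoid _) (↭⇒↭ₛ xs↭ys)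

applyUpTo-cong : ∀ {f g : ℕ → A} → (∀ i → f i ≡ g i) → ∀ n → applyUpTo f n ≡ applyUpTo g n
applyUpTo-cong f≗g zero    = refl
applyUpTo-cong f≗g (suc n) = cong₂ _∷_ (f≗g 0) (applyUpTo-cong (f≗g ∘ suc) n)

applyUpTo-++ : ∀ (f : ℕ → A) a b → applyUpTo f (a + b) ≡ applyUpTo f a ++ applyUpTo (λ i → f (a + i)) b
applyUpTo-++ f zero    b = refl
applyUpTo-++ f (suc a) b = cong (f 0 ∷_) (applyUpTo-++ (f ∘ suc) a b)

concat-applyUpTo-∷ʳ : ∀ (f : ℕ → List A) n → concat (applyUpTo f (suc n)) ≡ concat (applyUpTo f n) ++ f n
concat-applyUpTo-∷ʳ f n = begin
  concat (applyUpTo f (suc n))          ≡⟨ cong concat (applyUpTo-∷ʳ f n) ⟨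
  concat (applyUpTo f n ++ [ f n ])     ≡⟨ concat-++ (applyUpTo f n) [ f n ] ⟨
  concat (applyUpTo f n) ++ f n ++ []   ≡⟨ cong (concat (applyUpTo f n) ++_) (++-identityʳ (f n)) ⟩
  concat (applyUpTo f n) ++ f n         ∎
  where open ≡-Reasoning

concat-applyUpTo-++-↭ : ∀ (f g : ℕ → List A) n →
  concat (applyUpTo (λ i → f i ++ g i) n) ↭ concat (applyUpTo f n) ++ concat (applyUpTo g n)
concat-applyUpTo-++-↭ f g zero    = ↭-refl
concat-applyUpTo-++-↭ f g (suc n) = begin
  (f 0 ++ g 0) ++ concat (applyUpTo (λ i → f (suc i) ++ g (suc i)) n)
    ≡⟨ ++-assoc (f 0) (g 0) _ ⟩
  f 0 ++ g 0 ++ concat (applyUpTo (λ i → f (suc i) ++ g (suc i)) n)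
    ↭⟨ ++⁺ˡ (f 0) (++⁺ˡ (g 0) (concat-applyUpTo-++-↭ (f ∘ suc) (g ∘ suc) n)) ⟩
  f 0 ++ g 0 ++ concat (applyUpTo (f ∘ suc) n) ++ concat (applyUpTo (g ∘ suc) n)
    ↭⟨ ++⁺ˡ (f 0) (shifts (g 0) (concat (applyUpTo (f ∘ suc) n))) ⟩
  f 0 ++ concat (applyUpTo (f ∘ suc) n) ++ g 0 ++ concat (applyUpTo (g ∘ suc) n)
    ≡⟨ ++-assoc (f 0) (concat (applyUpTo (f ∘ suc) n)) _ ⟨
  (f 0 ++ concat (applyUpTo (f ∘ suc) n)) ++ g 0 ++ concat (applyUpTo (g ∘ suc) n) ∎
  where open PermutationReasoning

tabulate-toℕ : ∀ (f : ℕ → A) n → tabulate {n = n} (f ∘ toℕ) ≡ applyUpTo f n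
tabulate-toℕ f zero    = refl
tabulate-toℕ f (suc n) = cong (f 0 ∷_) (tabulate-toℕ (f ∘ suc) n)

map-toℕ-allFin : ∀ n → map toℕ (allFin n) ≡ upTo n
map-toℕ-allFin n = trans (map-tabulate id toℕ) (tabulate-toℕ id n)

[m+n]Cm*[m!*n!]≡[m+n]! : ∀ m n → ((m + n) C m) * (m ! * n !) ≡ (m + n) !
[m+n]Cm*[m!*n!]≡[m+n]! m n = begin
  ((m + n) C m) * (m ! * n !)             ≡⟨ cong (λ k → ((m + n) C m) * (m ! * k !)) (m+n∸m≡n m n) ⟨
  ((m + n) C m) * (m ! * (m + n ∸ m) !)   ≡⟨ cong (_* (m ! * (m + n ∸ m) !)) (nCk≡n!/k![n-k]! (m≤m+n m n)) ⟩
  (m + n) ! / (m ! * (m + n ∸ m) !) * _   ≡⟨ m/n*n≡m (k![n∸k]!∣n! (m≤m+n m n)) ⟩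
  (m + n) !                               ∎
  where
  open ≡-Reasoning
  instance _ = m !* (m + n ∸ m) !≢0

-- Interleavings

interleavings : List A → List A → List (List A)
interleavings []       ys       = [ ys ]
interleavings (x ∷ xs) []       = [ x ∷ xs ]
interleavings (x ∷ xs) (y ∷ ys) =
  map (x ∷_) (interleavings xs (y ∷ ys)) ++ map (y ∷_) (interleavings (x ∷ xs) ys)

∈-interleavings⁻ : ∀ (xs ys : List A) {zs} → zs ∈ interleavings xs ys → Interleaving xs ys zs
∈-interleavings⁻ []       ys       (here refl) = right (≡⇒Pointwise-≡ refl)
∈-interleavings⁻ (x ∷ xs) []       (here refl) = left (≡⇒Pointwise-≡ refl)
∈-interleavings⁻ (x ∷ xs) (y ∷ ys) zs∈ with ∈-++⁻ (map (x ∷_) (interleavings xs (y ∷ ys))) zs∈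
... | inj₁ zs∈ˡ with _ , ws∈ , refl ← ∈-map⁻ (x ∷_) zs∈ˡ = consˡ (∈-interleavings⁻ xs (y ∷ ys) ws∈)
... | inj₂ zs∈ʳ with _ , ws∈ , refl ← ∈-map⁻ (y ∷_) zs∈ʳ = consʳ (∈-interleavings⁻ (x ∷ xs) ys ws∈)

interleavings-unique : ∀ (xs ys : List A) → Disjoint xs ys → Unique (interleavings xs ys)
interleavings-unique []       ys       _     = [] ∷ []
interleavings-unique (x ∷ xs) []       _     = [] ∷ []
interleavings-unique (x ∷ xs) (y ∷ ys) xs#ys =
  Unique.++⁺ (Unique.map⁺ ∷-injectiveʳ (interleavings-unique xs (y ∷ ys) (λ (p , q) → xs#ys (there p , q))))
             (Unique.map⁺ ∷-injectiveʳ (interleavings-unique (x ∷ xs) ys (λ (p , q) → xs#ys (p , there q))))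
             heads-differ
  where
  heads-differ : Disjoint (map (x ∷_) (interleavings xs (y ∷ ys))) (map (y ∷_) (interleavings (x ∷ xs) ys))
  heads-differ (p , q) with _ , _ , refl ← ∈-map⁻ (x ∷_) p | _ , _ , x∷≡y∷ ← ∈-map⁻ (y ∷_) q =
    xs#ys (here refl , here (∷-injectiveˡ x∷≡y∷))

Interleaving-injective : Interleaving xs ys zs → Interleaving xs′ ys′ zs →
                         Disjoint xs ys′ → Disjoint xs′ ys → xs ≡ xs′ × ys ≡ ys′
Interleaving-injective []        []         _      _      = refl , refl
Interleaving-injective (consˡ i) (consˡ i′) xs#ys′ xs′#ys
  with refl , refl ← Interleaving-injective i i′ (λ (p , q) → xs#ys′ (there p , q)) (λ (p , q) → xs′#ys (there p , q))
  = refl , refl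
Interleaving-injective (consʳ i) (consʳ i′) xs#ys′ xs′#ys
  with refl , refl ← Interleaving-injective i i′ (λ (p , q) → xs#ys′ (p , there q)) (λ (p , q) → xs′#ys (p , there q))
  = refl , refl
Interleaving-injective (consˡ _) (consʳ _) xs#ys′ _      = ⊥-elim (xs#ys′ (here refl , here refl))
Interleaving-injective (consʳ _) (consˡ _) _      xs′#ys = ⊥-elim (xs′#ys (here refl , here refl))

length-interleavings : ∀ (xs ys : List A) →
                       length (interleavings xs ys) ≡ (length xs + length ys) C length xs
length-interleavings []       ys       = refl
length-interleavings (x ∷ xs) []       =
  sym (trans (cong (_C suc (length xs)) (+-identityʳ (suc (length xs)))) (nCn≡1 (suc (length xs))))
length-interleavings (x ∷ xs) (y ∷ ys) = begin
  length (map (x ∷_) (interleavings xs (y ∷ ys)) ++ map (y ∷_) (interleavings (x ∷ xs) ys))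
    ≡⟨ length-++ (map (x ∷_) (interleavings xs (y ∷ ys))) ⟩
  length (map (x ∷_) (interleavings xs (y ∷ ys))) + length (map (y ∷_) (interleavings (x ∷ xs) ys))
    ≡⟨ cong₂ _+_ (length-map (x ∷_) (interleavings xs (y ∷ ys))) (length-map (y ∷_) (interleavings (x ∷ xs) ys)) ⟩
  length (interleavings xs (y ∷ ys)) + length (interleavings (x ∷ xs) ys)
    ≡⟨ cong₂ _+_ (length-interleavings xs (y ∷ ys)) (length-interleavings (x ∷ xs) ys) ⟩
  (i + suc j) C i + suc (i + j) C suc i
    ≡⟨ cong (λ n → n C i + suc (i + j) C suc i) (+-suc i j) ⟩
  suc (i + j) C i + suc (i + j) C suc i
    ≡⟨ nCk+nC[k+1]≡[n+1]C[k+1] (suc (i + j)) i ⟩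
  suc (suc (i + j)) C suc i
    ≡⟨ cong (λ n → suc n C suc i) (+-suc i j) ⟨
  (suc i + suc j) C suc i ∎
  where
  open ≡-Reasoning
  i = length xs
  j = length ys

Sequential : (List A → A → Set) → List A → List A → Set
Sequential P seen []       = ⊤
Sequential P seen (v ∷ vs) = P seen v × Sequential P (v ∷ seen) vs

Monotone : (List A → A → Set) → Set
Monotone P = ∀ {seen seen′ v} → seen ⊆ seen′ → P seen v → P seen′ v

Sequential-mono : ∀ {P : List A → A → Set} {seen seen′} → Monotone P → seen ⊆ seen′ →
                  ∀ {vs} → Sequential P seen vs → Sequential P seen′ vs
Sequential-mono mono ⊆′ {[]}     _          = tt
Sequential-mono mono ⊆′ {v ∷ vs} (pv , pvs) = mono ⊆′ pv , Sequential-mono mono (∷⁺ʳ v ⊆′) pvs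

Sequential-interleaving : ∀ {P : List A → A → Set} {seen} → Monotone P →
                          Interleaving xs ys zs → Sequential P seen xs → Sequential P seen ys →
                          Sequential P seen zs
Sequential-interleaving mono []        _          _          = tt
Sequential-interleaving mono (consˡ i) (px , pxs) pys        =
  px , Sequential-interleaving mono i pxs (Sequential-mono mono (xs⊆x∷xs _ _) pys)
Sequential-interleaving mono (consʳ i) pxs        (py , pys) =
  py , Sequential-interleaving mono i (Sequential-mono mono (xs⊆x∷xs _ _) pxs) pys

-- Linear extensions of trees

preorder : Tree A ⊤ → List A
preorder (leaf _)     = []
preorder (node l v r) = v ∷ preorder l ++ preorder r

length-preorder : ∀ (t : Tree A ⊤) → length (preorder t) ≡ #nodes t
length-preorder (leaf _)     = refl
length-preorder (node l v r) = trans
  (cong suc (trans (length-++ (preorder l)) (cong₂ _+_ (length-preorder l) (length-preorder r))))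
  (sym (+-suc (#nodes l) (#nodes r)))

hookProduct : Tree A ⊤ → ℕ
hookProduct (leaf _)       = 1
hookProduct t@(node l _ r) = #nodes t * (hookProduct l * hookProduct r)

linearExtensions : Tree A ⊤ → List (List A)
linearExtensions (leaf _)     = [ [] ]
linearExtensions (node l v r) =
  map (v ∷_) (concatMap (uncurry interleavings) (cartesianProduct (linearExtensions l) (linearExtensions r)))

data NodeExtension (l : Tree A ⊤) (v : A) (r : Tree A ⊤) : List A → Set where
  extension : ∀ {p q zs} → p ∈ linearExtensions l → q ∈ linearExtensions r → Interleaving p q zs →
              NodeExtension l v r (v ∷ zs)

∈-linearExtensions⁻ : ∀ (l : Tree A ⊤) v r {w} → w ∈ linearExtensions (node l v r) → NodeExtension l v r w
∈-linearExtensions⁻ l v r w∈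
  with zs , zs∈ , refl ← ∈-map⁻ (v ∷_) w∈
  with (p , q) , pq∈ , zs∈pq ← find (∈-concatMap⁻ (uncurry interleavings) {xs = cartesianProduct (linearExtensions l) (linearExtensions r)} zs∈)
  with p∈ , q∈ ← ∈-cartesianProduct⁻ (linearExtensions l) (linearExtensions r) pq∈
  = extension p∈ q∈ (∈-interleavings⁻ p q zs∈pq)

∈-linearExtensions⇒↭ : ∀ (t : Tree A ⊤) {w} → w ∈ linearExtensions t → w ↭ preorder t
∈-linearExtensions⇒↭ (leaf _)     (here refl) = ↭-refl
∈-linearExtensions⇒↭ (node l v r) w∈ with extension p∈ q∈ i ← ∈-linearExtensions⁻ l v r w∈ =
  prep v (↭-trans (toPermutation i) (++⁺ (∈-linearExtensions⇒↭ l p∈) (∈-linearExtensions⇒↭ r q∈)))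

∈-linearExtensions⇒length : ∀ (t : Tree A ⊤) {w} → w ∈ linearExtensions t → length w ≡ #nodes t
∈-linearExtensions⇒length t w∈ = trans (↭-length (∈-linearExtensions⇒↭ t w∈)) (length-preorder t)

linearExtensions-unique : ∀ (t : Tree A ⊤) → Unique (preorder t) → Unique (linearExtensions t)
linearExtensions-unique (leaf _)     _           = [] ∷ []
linearExtensions-unique (node l v r) (_ ∷ l++r!) with l! , r! , l#r ← Unique-++⁻ (preorder l) l++r! =
  Unique.map⁺ ∷-injectiveʳ
    (Unique-concatMap⁺ (uncurry interleavings)
      (Unique.cartesianProduct⁺ (linearExtensions-unique l l!) (linearExtensions-unique r r!))
      (λ pq∈ → let p∈ , q∈ = ∈-cartesianProduct⁻ _ _ pq∈ in interleavings-unique _ _ (disjoint p∈ q∈))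
      injective)
  where
  disjoint : ∀ {p q} → p ∈ linearExtensions l → q ∈ linearExtensions r → Disjoint p q
  disjoint p∈ q∈ (a∈p , a∈q) =
    l#r (∈-resp-↭ (∈-linearExtensions⇒↭ l p∈) a∈p , ∈-resp-↭ (∈-linearExtensions⇒↭ r q∈) a∈q)

  injective : ∀ {pq pq′ zs} → pq ∈ cartesianProduct (linearExtensions l) (linearExtensions r) →
              pq′ ∈ cartesianProduct (linearExtensions l) (linearExtensions r) →
              zs ∈ uncurry interleavings pq → zs ∈ uncurry interleavings pq′ → pq ≡ pq′
  injective {p , q} {p′ , q′} pq∈ pq′∈ zs∈ zs∈′
    with p∈ , q∈ ← ∈-cartesianProduct⁻ _ _ pq∈ | p′∈ , q′∈ ← ∈-cartesianProduct⁻ _ _ pq′∈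
    with refl , refl ← Interleaving-injective (∈-interleavings⁻ p q zs∈) (∈-interleavings⁻ p′ q′ zs∈′)
                         (disjoint p∈ q′∈) (disjoint p′∈ q∈)
    = refl

length-linearExtensions-node : ∀ (l : Tree A ⊤) v r →
  length (linearExtensions (node l v r)) ≡
  length (linearExtensions l) * length (linearExtensions r) * ((#nodes l + #nodes r) C #nodes l)
length-linearExtensions-node l v r = begin
  length (map (v ∷_) (concatMap (uncurry interleavings) pairs))
    ≡⟨ length-map (v ∷_) (concatMap (uncurry interleavings) pairs) ⟩
  length (concatMap (uncurry interleavings) pairs)
    ≡⟨ length-concatMap (uncurry interleavings) pairs length-pair ⟩
  length pairs * ((#nodes l + #nodes r) C #nodes l)
    ≡⟨ cong (_* ((#nodes l + #nodes r) C #nodes l)) (length-cartesianProduct (linearExtensions l) (linearExtensions r)) ⟩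
  length (linearExtensions l) * length (linearExtensions r) * ((#nodes l + #nodes r) C #nodes l) ∎
  where
  open ≡-Reasoning
  pairs = cartesianProduct (linearExtensions l) (linearExtensions r)
  length-pair : ∀ {pq} → pq ∈ pairs → length (uncurry interleavings pq) ≡ (#nodes l + #nodes r) C #nodes l
  length-pair {p , q} pq∈ with p∈ , q∈ ← ∈-cartesianProduct⁻ _ _ pq∈ =
    trans (length-interleavings p q)
          (cong₂ (λ a b → (a + b) C a) (∈-linearExtensions⇒length l p∈) (∈-linearExtensions⇒length r q∈))

hook-length-formula : ∀ (t : Tree A ⊤) → length (linearExtensions t) * hookProduct t ≡ #nodes t !
hook-length-formula (leaf _)     = refl
hook-length-formula (node l v r) = begin
  length (linearExtensions (node l v r)) * (n * (hₗ * hᵣ))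
    ≡⟨ cong (_* (n * (hₗ * hᵣ))) (length-linearExtensions-node l v r) ⟩
  eₗ * eᵣ * ((i + j) C i) * (n * (hₗ * hᵣ))
    ≡⟨ rearrange eₗ eᵣ ((i + j) C i) n hₗ hᵣ ⟩
  n * (((i + j) C i) * (eₗ * hₗ * (eᵣ * hᵣ)))
    ≡⟨ cong (λ k → n * (((i + j) C i) * k)) (cong₂ _*_ (hook-length-formula l) (hook-length-formula r)) ⟩
  n * (((i + j) C i) * (i ! * j !))
    ≡⟨ cong (n *_) ([m+n]Cm*[m!*n!]≡[m+n]! i j) ⟩
  n * (i + j) !
    ≡⟨ cong (_* (i + j) !) (+-suc i j) ⟩
  suc (i + j) !
    ≡⟨ cong _! (+-suc i j) ⟨
  n ! ∎
  where
  open ≡-Reasoning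
  i = #nodes l
  j = #nodes r
  n = #nodes (node l v r)
  eₗ = length (linearExtensions l)
  eᵣ = length (linearExtensions r)
  hₗ = hookProduct l
  hᵣ = hookProduct r
  rearrange : ∀ a b c d e f → a * b * c * (d * (e * f)) ≡ d * (c * (a * e * (b * f)))
  rearrange = solve-∀

-- The heap

-- The depth-m subtree rooted at c of the heap-ordered binary tree underlying BINGraph.
heap : ℕ → ℕ → Tree ℕ ⊤
heap zero    c = leaf tt
heap (suc m) c = node (heap m (suc (c + c))) c (heap m (suc (suc (c + c))))

suc-#nodes-heap : ∀ m c → suc (#nodes (heap m c)) ≡ 2 ^ m
suc-#nodes-heap zero    c = refl
suc-#nodes-heap (suc m) c =
  trans (cong₂ _+_ (suc-#nodes-heap m (suc (c + c))) (suc-#nodes-heap m (suc (suc (c + c)))))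
        (cong (2 ^ m +_) (sym (+-identityʳ (2 ^ m))))

-- The factor 2 ^ (2 + m) is what makes the induction go through.
hookProduct-heap-≤ : ∀ m c → hookProduct (heap m c) * 2 ^ (2 + m) ≤ 2 ^ (2 ^ (1 + m))
hookProduct-heap-≤ zero    c = ≤-refl
hookProduct-heap-≤ (suc m) c = begin
  n * (hₗ * hᵣ) * (2 * (2 * (2 * a)))         ≤⟨ *-monoˡ-≤ (2 * (2 * (2 * a))) (*-monoˡ-≤ (hₗ * hᵣ) n≤2a) ⟩
  2 * a * (hₗ * hᵣ) * (2 * (2 * (2 * a)))     ≡⟨ rearrange a hₗ hᵣ ⟩
  (hₗ * (2 * (2 * a))) * (hᵣ * (2 * (2 * a))) ≤⟨ *-mono-≤ (hookProduct-heap-≤ m _) (hookProduct-heap-≤ m _) ⟩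
  2 ^ (2 * a) * 2 ^ (2 * a)                   ≡⟨ ^-distribˡ-+-* 2 (2 * a) (2 * a) ⟨
  2 ^ (2 * a + 2 * a)                         ≡⟨ cong (λ k → 2 ^ (2 * a + k)) (+-identityʳ (2 * a)) ⟨
  2 ^ (2 ^ (2 + m))                           ∎
  where
  open ≤-Reasoning
  a = 2 ^ m
  n = #nodes (heap (suc m) c)
  hₗ = hookProduct (heap m (suc (c + c)))
  hᵣ = hookProduct (heap m (suc (suc (c + c))))
  n≤2a : n ≤ 2 * a
  n≤2a = ≤-trans (n≤1+n n) (≤-reflexive (suc-#nodes-heap (suc m) c))
  rearrange : ∀ a h h′ → 2 * a * (h * h′) * (2 * (2 * (2 * a))) ≡ (h * (2 * (2 * a))) * (h′ * (2 * (2 * a)))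
  rearrange = solve-∀

-- In 1-based numbering the descendants of c at depth d are the 2^d consecutive labels from (c+1)·2^d.
descendants : ℕ → ℕ → List ℕ
descendants c d = applyUpTo (suc c * 2 ^ d +_) (2 ^ d)

descendants-suc : ∀ c d → descendants c (suc d) ≡ descendants (suc (c + c)) d ++ descendants (suc (suc (c + c))) d
descendants-suc c d = begin
  applyUpTo (suc c * (2 * a) +_) (a + (a + 0))
    ≡⟨ cong (applyUpTo (suc c * (2 * a) +_)) (cong (a +_) (+-identityʳ a)) ⟩
  applyUpTo (suc c * (2 * a) +_) (a + a)
    ≡⟨ applyUpTo-++ (suc c * (2 * a) +_) a a ⟩
  applyUpTo (suc c * (2 * a) +_) a ++ applyUpTo (λ i → suc c * (2 * a) + (a + i)) a
    ≡⟨ cong₂ _++_ (applyUpTo-cong (left-offset c a) a) (applyUpTo-cong (right-offset c a) a) ⟩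
  descendants (suc (c + c)) d ++ descendants (suc (suc (c + c))) d ∎
  where
  open ≡-Reasoning
  a = 2 ^ d
  left-offset : ∀ c a i → suc c * (2 * a) + i ≡ suc (suc (c + c)) * a + i
  left-offset = solve-∀
  right-offset : ∀ c a i → suc c * (2 * a) + (a + i) ≡ suc (suc (suc (c + c))) * a + i
  right-offset = solve-∀

map-suc-preorder-heap : ∀ m c → map suc (preorder (heap m c)) ↭ concat (applyUpTo (descendants c) m)
map-suc-preorder-heap zero    c = ↭-refl
map-suc-preorder-heap (suc m) c = begin
  suc c ∷ map suc (preorder l ++ preorder r)
    ≡⟨ cong (suc c ∷_) (map-++ suc (preorder l) (preorder r)) ⟩
  suc c ∷ map suc (preorder l) ++ map suc (preorder r)
    ↭⟨ prep (suc c) (++⁺ (map-suc-preorder-heap m cₗ) (map-suc-preorder-heap m cᵣ)) ⟩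
  suc c ∷ concat (applyUpTo (descendants cₗ) m) ++ concat (applyUpTo (descendants cᵣ) m)
    ↭⟨ prep (suc c) (concat-applyUpTo-++-↭ (descendants cₗ) (descendants cᵣ) m) ⟨
  suc c ∷ concat (applyUpTo (λ d → descendants cₗ d ++ descendants cᵣ d) m)
    ≡⟨ cong₂ (λ x xss → x ∷ concat xss) (root c) (applyUpTo-cong (λ d → sym (descendants-suc c d)) m) ⟩
  concat (applyUpTo (descendants c) (suc m)) ∎
  where
  open PermutationReasoning
  cₗ = suc (c + c)
  cᵣ = suc (suc (c + c))
  l = heap m cₗ
  r = heap m cᵣ
  root : ∀ c → suc c ≡ suc c * 1 + 0
  root = solve-∀

concat-descendants-0 : ∀ m → concat (applyUpTo (descendants 0) m) ≡ applyUpTo suc (2 ^ m ∸ 1)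
concat-descendants-0 zero    = refl
concat-descendants-0 (suc m) = begin
  concat (applyUpTo (descendants 0) (suc m))
    ≡⟨ concat-applyUpTo-∷ʳ (descendants 0) m ⟩
  concat (applyUpTo (descendants 0) m) ++ descendants 0 m
    ≡⟨ cong₂ _++_ (concat-descendants-0 m) (applyUpTo-cong offset a) ⟩
  applyUpTo suc k ++ applyUpTo (λ i → suc (k + i)) a
    ≡⟨ applyUpTo-++ suc k a ⟨
  applyUpTo suc (k + a)
    ≡⟨ cong (λ x → applyUpTo suc ((x + a) ∸ 1)) 1+k≡a ⟩
  applyUpTo suc (a + a ∸ 1)
    ≡⟨ cong (λ x → applyUpTo suc (a + x ∸ 1)) (+-identityʳ a) ⟨
  applyUpTo suc (2 ^ suc m ∸ 1) ∎
  where
  open ≡-Reasoning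
  a = 2 ^ m
  k = a ∸ 1
  1+k≡a : suc k ≡ a
  1+k≡a = m+[n∸m]≡n (m^n>0 2 m)
  offset : ∀ i → suc 0 * a + i ≡ suc (k + i)
  offset i = cong (_+ i) (trans (+-identityʳ a) (sym 1+k≡a))

preorder-heap↭upTo : ∀ m → preorder (heap m 0) ↭ upTo (2 ^ m ∸ 1)
preorder-heap↭upTo m
  with ys , suc-n≡suc-ys , preorder↭ys ← ↭-map-inv suc (↭-trans (map-suc-preorder-heap m 0) (↭-reflexive (concat-descendants-0 m)))
  with refl ← map-injective suc-injective (trans (map-upTo suc (2 ^ m ∸ 1)) suc-n≡suc-ys)
  = preorder↭ys

_IsParentOf_ : ℕ → ℕ → Set
p IsParentOf v = suc p ≡ suc v / 2

parent-unique : ∀ {p p′} v → p IsParentOf v → p′ IsParentOf v → p ≡ p′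
parent-unique _ p-parent p′-parent = suc-injective (trans p-parent (sym p′-parent))

[2+n]/2≡1+n/2 : ∀ n → (2 + n) / 2 ≡ suc (n / 2)
[2+n]/2≡1+n/2 n = m/n≡1+[m∸n]/n {2 + n} (s≤s (s≤s z≤n))

[c+c]/2≡c : ∀ c → (c + c) / 2 ≡ c
[c+c]/2≡c zero    = refl
[c+c]/2≡c (suc c) =
  trans (cong (λ k → suc k / 2) (+-suc c c)) (trans ([2+n]/2≡1+n/2 (c + c)) (cong suc ([c+c]/2≡c c)))

[1+c+c]/2≡c : ∀ c → suc (c + c) / 2 ≡ c
[1+c+c]/2≡c zero    = refl
[1+c+c]/2≡c (suc c) =
  trans (cong (λ k → suc (suc k) / 2) (+-suc c c)) (trans ([2+n]/2≡1+n/2 (suc (c + c))) (cong suc ([1+c+c]/2≡c c)))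

parent-of-left : ∀ c → c IsParentOf suc (c + c)
parent-of-left c = sym (trans ([2+n]/2≡1+n/2 (c + c)) (cong suc ([c+c]/2≡c c)))

parent-of-right : ∀ c → c IsParentOf suc (suc (c + c))
parent-of-right c = sym (trans ([2+n]/2≡1+n/2 (suc (c + c))) (cong suc ([1+c+c]/2≡c c)))

HasParentIn : List ℕ → ℕ → Set
HasParentIn seen v = v ≡ 0 ⊎ Any (_IsParentOf v) seen

HasParentIn-mono : Monotone HasParentIn
HasParentIn-mono seen⊆ = Sum.map₂ (Any-resp-⊆ seen⊆)

ParentFirst : List ℕ → List ℕ → Set
ParentFirst = Sequential HasParentIn

ParentClosed : List ℕ → Set
ParentClosed seen = All (HasParentIn seen) seen

linearExtensions-heap-parentFirst : ∀ m c {seen w} → HasParentIn seen c →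
                                    w ∈ linearExtensions (heap m c) → ParentFirst seen w
linearExtensions-heap-parentFirst zero    c _  (here refl) = tt
linearExtensions-heap-parentFirst (suc m) c hc w∈
  with extension p∈ q∈ i ← ∈-linearExtensions⁻ (heap m (suc (c + c))) c (heap m (suc (suc (c + c)))) w∈ =
  hc , Sequential-interleaving HasParentIn-mono i
         (linearExtensions-heap-parentFirst m _ (inj₂ (here (parent-of-left c))) p∈)
         (linearExtensions-heap-parentFirst m _ (inj₂ (here (parent-of-right c))) q∈)

length-linearExtensions-heap-≥ : ∀ m → (2 ^ m ∸ 1) ! ≤ length (linearExtensions (heap m 0)) * 2 ^ (2 * 2 ^ m)
length-linearExtensions-heap-≥ m = begin
  (2 ^ m ∸ 1) !                         ≡⟨ cong (λ k → (k ∸ 1) !) (suc-#nodes-heap m 0) ⟨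
  #nodes (heap m 0) !                   ≡⟨ hook-length-formula (heap m 0) ⟨
  e * hookProduct (heap m 0)            ≤⟨ *-monoʳ-≤ e (≤-trans (m≤m*n _ (2 ^ (2 + m))) (hookProduct-heap-≤ m 0)) ⟩
  e * 2 ^ (2 * 2 ^ m)                   ∎
  where
  open ≤-Reasoning
  e = length (linearExtensions (heap m 0))
  instance _ = m^n≢0 2 (2 + m)

-- The graph BIN

isParent⇒IsParentOf : ∀ a b → T (isParent a b) → b IsParentOf a
isParent⇒IsParentOf a b = ≡ᵇ⇒≡ (suc b) (suc a / 2)

BIN-adjacent : ∀ {n} (u v : Fin n) → BINGraph n u v ≡ true →
               toℕ v IsParentOf toℕ u ⊎ toℕ u IsParentOf toℕ v
BIN-adjacent u v adjacent =
  Sum.map (isParent⇒IsParentOf (toℕ u) (toℕ v)) (isParent⇒IsParentOf (toℕ v) (toℕ u))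
          (Equivalence.to (T-∨ {isParent (toℕ u) (toℕ v)}) (Equivalence.from T-≡ adjacent))

precNbrs-BIN≤1 : ∀ {n} {v : Fin n} {seen} → Unique seen → v ∉ seen → ParentClosed (map toℕ seen) →
                 precNbrs (BINGraph n) v seen ≤ 1
precNbrs-BIN≤1 {n} {v} {seen} seen! v∉ closed =
  length-filter≤1 (λ u → BINGraph n u v Bool.≟ true) seen! λ u∈ u′∈ adj adj′ →
    toℕ-injective (parent-unique (toℕ v) (seen-neighbour⇒parent u∈ adj) (seen-neighbour⇒parent u′∈ adj′))
  where
  -- A seen child u of v would have its parent v among the seen vertices.
  seen-neighbour⇒parent : ∀ {u} → u ∈ seen → BINGraph n u v ≡ true → toℕ u IsParentOf toℕ v
  seen-neighbour⇒parent {u} u∈ adj with BIN-adjacent u v adj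
  ... | inj₂ u-parent = u-parent
  ... | inj₁ v-parent with All.lookup closed (∈-map⁺ toℕ u∈)
  ...   | inj₁ u≡0 = ⊥-elim (0≢1+n (trans (sym (cong (λ k → suc k / 2) u≡0)) (sym v-parent)))
  ...   | inj₂ has-parent with p , p∈ , p-parent ← find has-parent
          with w , w∈ , refl ← ∈-map⁻ toℕ p∈ =
    ⊥-elim (v∉ (subst (_∈ seen) (toℕ-injective (parent-unique (toℕ u) p-parent v-parent)) w∈))

parentFirst⇒AllT2 : ∀ {n} {seen π : List (Fin n)} → Unique seen → All (_∉ seen) π → Unique π →
                    ParentClosed (map toℕ seen) → ParentFirst (map toℕ seen) (map toℕ π) →
                    AllT2 (BINGraph n) seen π
parentFirst⇒AllT2 {π = []}    _     _          _          _      _          = tt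
parentFirst⇒AllT2 {π = v ∷ π} seen! (v∉ ∷ π∉) (v∉π ∷ π!) closed (hv , hπ) =
  precNbrs-BIN≤1 seen! v∉ closed ,
  parentFirst⇒AllT2 (All.tabulate (λ u∈ v≡u → v∉ (subst (_∈ _) (sym v≡u) u∈)) ∷ seen!)
                    (All.zipWith fresh (v∉π , π∉)) π!
                    (HasParentIn-mono (xs⊆x∷xs _ _) hv ∷ All.map (HasParentIn-mono (xs⊆x∷xs _ _)) closed) hπ
  where
  fresh : ∀ {u} → v ≢ u × u ∉ _ → u ∉ v ∷ _
  fresh (v≢u , u∉) (here refl) = v≢u refl
  fresh (v≢u , u∉) (there u∈)  = u∉ u∈

T2IsWhole-heap : ∀ m {π : List (Fin (2 ^ m ∸ 1))} → π ↭ allFin (2 ^ m ∸ 1) →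
                 map toℕ π ∈ linearExtensions (heap m 0) → T2IsWhole (BIN (2 ^ m)) π
T2IsWhole-heap m π↭ π∈ =
  parentFirst⇒AllT2 [] (All.tabulate λ _ ()) (Unique-resp-↭ (↭-sym π↭) (Unique.allFin⁺ _)) []
                    (linearExtensions-heap-parentFirst m 0 (inj₁ refl) π∈)

liftOrderings : ∀ {n} (ws : List (List ℕ)) → All (_↭ upTo n) ws →
                ∃[ πs ] map (map toℕ) πs ≡ ws × All (_↭ allFin n) πs
liftOrderings       []       []         = [] , refl , []
liftOrderings {n} (w ∷ ws) (w↭ ∷ ws↭)
  with π , refl , allFin↭π ← ↭-map-inv toℕ (↭-trans (↭-reflexive (map-toℕ-allFin n)) (↭-sym w↭))
  with πs , refl , πs↭ ← liftOrderings ws ws↭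
  = π ∷ πs , refl , ↭-sym allFin↭π ∷ πs↭

proposition2p3 : (m : ℕ) →
    Σ (List (List (Fin (2 ^ m ∸ 1)))) λ πs →
    Unique πs
    × All (λ π → (π ↭ allFin (2 ^ m ∸ 1)) × T2IsWhole (BIN (2 ^ m)) π) πs
    × ((2 ^ m ∸ 1) ! ≤ length πs * 2 ^ (2 * 2 ^ m))
proposition2p3 m =
  let πs , toℕ-πs , πs↭ = liftOrderings extensions (All.tabulate extension↭)
      πs-extensions = All.map⁻ (subst (All (_∈ extensions)) (sym toℕ-πs) (All.tabulate id))
  in πs
   , Unique.map⁻ (subst Unique (sym toℕ-πs) extensions-unique)
   , All.zipWith (λ (π↭ , π∈) → π↭ , T2IsWhole-heap m π↭ π∈) (πs↭ , πs-extensions)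
   , subst (λ k → (2 ^ m ∸ 1) ! ≤ k * 2 ^ (2 * 2 ^ m))
           (trans (cong length (sym toℕ-πs)) (length-map (map toℕ) πs)) (length-linearExtensions-heap-≥ m)
  where
  extensions = linearExtensions (heap m 0)
  extension↭ : ∀ {w} → w ∈ extensions → w ↭ upTo (2 ^ m ∸ 1)
  extension↭ w∈ = ↭-trans (∈-linearExtensions⇒↭ (heap m 0) w∈) (preorder-heap↭upTo m)
  extensions-unique : Unique extensions
  extensions-unique = linearExtensions-unique (heap m 0) (Unique-resp-↭ (↭-sym (preorder-heap↭upTo m)) (Unique.upTo⁺ _))
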